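{- Let $q$ be a prime power, let $\mathcal{S}\subseteq\mathcal{R}_{\text{monic}}$ be an infinite set, let $m,n\in\mathbb{N}$, let $k\le m_{\mathcal{S}}(n)$, let $Q\in\mathcal{R}_{=k}\cap\mathcal{S}$, and let $\boldsymbol{\alpha}\in\mathfrak{m}^m$. If $Q_{\min,\mathcal{S}}(\boldsymbol{\alpha},q^{ -n})=Q$, then there exists $\mathbf{P}\in\mathcal{R}_{<k}^m$ such that $(\mathbf{P},Q)\in\widehat{\mathcal{R}}^{m+1}$ and for every $\frac{\mathbf{A}}{B}\in\mathcal{F}^m_{k-1,\mathcal{S}}$ one has $\left\|\frac{\mathbf{A}}{B}-\frac{\mathbf{P}}{Q}\right\|\ge q^{ -n}$.
   Context: Let $\mathcal{R}=\mathbb{F}_q[x]$, $\mathcal{R}_{<n}=\{f\in\mathcal{R}:\deg f<n\}$, $\mathcal{R}_{=n}=\{f\in\mathcal{R}:\deg f=n\}$, and $\mathcal{R}_{\text{monic}}$ the set of monic polynomials. Let $\mathcal{K}=\mathbb{F}_q(x)$ with absolute value $|f/g|=q^{\deg f-\deg g}$, and $\mathcal{K}_\infty=\mathbb{F}_q((x^{ -1}))$ its completion. On $\mathcal{K}_\infty^m$ use the norm $\|\mathbf{v}\|=\max_i|v_i|$. Let $\mathfrak{m}=\{\alpha\in\mathcal{K}_\infty:|\alpha|\le q^{ -1}\}$. A vector $(v_1,\dots,v_{m+1})\in\mathcal{R}^{m+1}$ is primitive if $\gcd(v_1,\dots,v_{m+1})=1$; the set of primitive vectors is $\widehat{\mathcal{R}}^{m+1}$.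 Let $m_{\mathcal{S}}(n)=\min\{k\ge n:\mathcal{S}\cap\mathcal{R}_{=k}\neq\emptyset\}$. The $\mathcal{S}$ Farey fractions of degree at most $k$ are $$\mathcal{F}^m_{k,\mathcal{S}}=\left\{\tfrac{\mathbf{P}}{Q}:\mathbf{P}\in\mathcal{R}^m,\ Q\in\mathcal{S},\ (\mathbf{P},Q)\in\widehat{\mathcal{R}}^{m+1},\ \|\mathbf{P}\|<|Q|\le q^k\right\}.$$ For $\boldsymbol{\alpha}\in\mathcal{K}_\infty^m$, $$\mathrm{deg}_{\min,\mathcal{S}}(\boldsymbol{\alpha},q^{ -n})=\min\left\{d:\exists\,\mathbf{P}\in\mathcal{R}^m,\,Q\in\mathcal{S}\cap\mathcal{R}_{=d},\ (\mathbf{P},Q)\in\widehat{\mathcal{R}}^{m+1},\ \|\mathbf{P}\|<|Q|,\ \left\|\boldsymbol{\alpha}-\tfrac{\mathbf{P}}{Q}\right\|<q^{ -n}\right\}.$$ A polynomial $Q\in\mathcal{S}$ is an $\mathcal{S}$ minimal denominator for $(\boldsymbol{\alpha},q^{ -n})$ if $\deg Q=\mathrm{deg}_{\min,\mathcal{S}}(\boldsymbol{\alpha},q^{ -n})$ and there is $\mathbf{P}\in\mathcal{R}^m$ with $(\mathbf{P},Q)\in\widehat{\mathcal{R}}^{m+1}$ and $\|\boldsymbol{\alpha}-\mathbf{P}/Q\|<q^{ -n}$. It is known that for $\boldsymbol{\alpha}\in\mathfrak{m}^m$ there is a unique monic $\mathcal{S}$ minimal denominator, denoted $Q_{\min,\mathcal{S}}(\boldsymbol{\alpha},q^{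 -n})$. -}

module Defs where

open import Level using (0ℓ)
open import Data.Nat as ℕ using (ℕ; zero; suc)
open import Data.Integer as ℤ using (ℤ; +_; -[1+_])
open import Data.Fin using (Fin; zero; suc)
open import Data.List using (List; []; _∷_)
open import Data.List.Membership.Propositional using (_∈_)
open import Data.Product using (Σ; ∃; _×_; _,_)
open import Relation.Binary.PropositionalEquality using (_≡_; _≢_)
open import Relation.Nullary using (¬_)
open import Algebra.Structures using (IsCommutativeRing)
open import Function.Bundles using (_↔_)

-- A finite field F_q (q = its cardinality; q is then automatically a
-- prime power, and every prime power arises this way).

record FiniteField : Set₁ where
  field
    Carrier : Set
    _+_ _*_ : Carrier → Carrier → Carrier
    -_      : Carrier → Carrier
    0# 1#   : Carrier
    isCommutativeRing : IsCommutativeRing _≡_ _+_ _*_ -_ 0# 1#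
    0≢1     : 0# ≢ 1#
    inverse : ∀ x → x ≢ 0# → ∃ λ y → x * y ≡ 1#
    q       : ℕ
    enum    : Fin q ↔ Carrier

  infixl 6 _+_
  infixl 7 _*_

module Poly (𝔽 : FiniteField) where
  open FiniteField 𝔽

  -- Polynomials in F_q[x]: coefficient lists (constant term first),
  -- considered up to coefficientwise equality _≈_.

  Pol : Set
  Pol = List Carrier

  coeff : Pol → ℕ → Carrier
  coeff []      _       = 0#
  coeff (a ∷ p) zero    = a
  coeff (a ∷ p) (suc i) = coeff p i

  _≈_ : Pol → Pol → Set
  p ≈ r = ∀ i → coeff p i ≡ coeff r i

  _⊕_ : Pol → Pol → Pol
  []      ⊕ r       = r
  (a ∷ p) ⊕ []      = a ∷ p
  (a ∷ p) ⊕ (b ∷ r) = (a + b) ∷ (p ⊕ r)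

  scale : Carrier → Pol → Pol
  scale c []      = []
  scale c (a ∷ p) = (c * a) ∷ scale c p

  _⊗_ : Pol → Pol → Pol
  []      ⊗ r = []
  (a ∷ p) ⊗ r = scale a r ⊕ (0# ∷ (p ⊗ r))

  one : Pol
  one = 1# ∷ []

  DegEq : Pol → ℕ → Set
  DegEq p d = coeff p d ≢ 0# × (∀ i → d ℕ.< i → coeff p i ≡ 0#)

  -- deg p < d   (i.e. p ∈ R_{<d}; the zero polynomial has degree -∞)
  DegLt : Pol → ℕ → Set
  DegLt p d = ∀ i → d ℕ.≤ i → coeff p i ≡ 0#

  Monic : Pol → Set
  Monic p = ∃ λ d → DegEq p d × coeff p d ≡ 1#

  _∣_ : Pol → Pol → Set
  d ∣ f = ∃ λ g → (d ⊗ g) ≈ f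

  Primitive : ∀ {r} → (Fin r → Pol) → Set
  Primitive {r} v = ∀ d → (∀ i → d ∣ v i) → d ∣ one

  _,,_ : ∀ {m} → (Fin m → Pol) → Pol → Fin (suc m) → Pol
  _,,_ {zero}  P Q zero    = Q
  _,,_ {suc m} P Q zero    = P zero
  _,,_ {suc m} P Q (suc i) = _,,_ {m} (λ j → P (suc j)) Q i

  PolSet : Set₁
  PolSet = Pol → Set

  RespectsEq : PolSet → Set
  RespectsEq S = ∀ p r → p ≈ r → S p → S r

  SubsetMonic : PolSet → Set
  SubsetMonic S = ∀ p → S p → Monic p

  Infinite : PolSet → Set
  Infinite S = (l : List Pol) → ∃ λ p → S p × (∀ r → r ∈ l → ¬ (p ≈ r))

  IsMS : PolSet → ℕ → ℕ → Set
  IsMS S n M = n ℕ.≤ M × (∃ λ p → S p × DegEq p M)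
             × (∀ k p → n ℕ.≤ k → S p → DegEq p k → M ℕ.≤ k)

  -- Laurent series K_∞ = F_q((x^{-1})): an element is given by its
  -- coefficient function i ↦ (coefficient of x^i), i ∈ ℤ.

  Series : Set
  Series = ℤ → Carrier

  _⊖_ : Series → Series → Series
  (α ⊖ β) i = α i + (- β i)

  -- α ∈ 𝔪  ⇔ |α| ≤ q^{-1} ⇔ all coefficients of x^i, i ≥ 0, vanish
  In𝔪 : Series → Set
  In𝔪 α = ∀ i → + 0 ℤ.≤ i → α i ≡ 0#

  -- |β| < q^{-n}  ⇔ all coefficients of x^i with i ≥ -n vanish
  NormLt : Series → ℕ → Set
  NormLt β n = ∀ i → ℤ.- (+ n) ℤ.≤ i → β i ≡ 0#

  NormGe : Series → ℕ → Set
  NormGe β n = ∃ λ i → ℤ.- (+ n) ℤ.≤ i × β i ≢ 0#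

  NormLtᵥ : ∀ {m} → (Fin m → Series) → ℕ → Set
  NormLtᵥ β n = ∀ j → NormLt (β j) n

  NormGeᵥ : ∀ {m} → (Fin m → Series) → ℕ → Set
  NormGeᵥ {m} β n = Σ (Fin m) λ j → NormGe (β j) n

  _⊛_ : Pol → Series → Series
  ([]      ⊛ C) t = 0#
  ((a ∷ p) ⊛ C) t = a * C t + (p ⊛ C) (t ℤ.- + 1)

  coeffℤ : Pol → ℤ → Carrier
  coeffℤ p (+ i)     = coeff p i
  coeffℤ p -[1+ i ]  = 0#

  -- C is the Laurent expansion of P/Q in K_∞ :  C ∈ K_∞ and Q·C = P
  IsQuot : Series → Pol → Pol → Set
  IsQuot C P Q = (∃ λ N → ∀ i → N ℤ.< i → C i ≡ 0#)
               × (∀ t → (Q ⊛ C) t ≡ coeffℤ P t)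

  Close : ∀ {m} → (Fin m → Series) → (Fin m → Pol) → Pol → ℕ → Set
  Close {m} α P Q n = ∃ λ (C : Fin m → Series) →
    (∀ j → IsQuot (C j) (P j) Q) × NormLtᵥ (λ j → α j ⊖ C j) n

  Admissible : ∀ {m} → PolSet → (Fin m → Series) → ℕ → Pol → ℕ → Set
  Admissible {m} S α n Q' d = S Q' × DegEq Q' d ×
    ∃ λ (P : Fin m → Pol) → Primitive (P ,, Q') × (∀ j → DegLt (P j) d)
                          × Close α P Q' n

  IsDegMin : ∀ {m} → PolSet → (Fin m → Series) → ℕ → ℕ → Set
  IsDegMin S α n d = (∃ λ Q' → Admissible S α n Q' d)
                   × (∀ Q' d' → Admissible S α n Q' d' → d ℕ.≤ d')

  IsMinDenom : ∀ {m} → PolSet → (Fin m → Series) → ℕ → Pol → Set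
  IsMinDenom {m} S α n Q = S Q × ∃ λ d → IsDegMin S α n d × DegEq Q d ×
    ∃ λ (P : Fin m → Pol) → Primitive (P ,, Q) × Close α P Q n

  QminIs : ∀ {m} → PolSet → (Fin m → Series) → ℕ → Pol → Set
  QminIs S α n Q = Monic Q × IsMinDenom S α n Q

  -- A/B ∈ F^m_{k-1,S}  (i.e. |B| ≤ q^{k-1}, equivalently deg B < k)
  FareyBelow : ∀ {m} → PolSet → ℕ → (Fin m → Pol) → Pol → Set
  FareyBelow S k A B = S B × Primitive (A ,, B) ×
    ∃ λ d → DegEq B d × d ℕ.< k × (∀ j → DegLt (A j) d)

-- The minimal denominator Q comes with a fraction P/Q such that
-- ‖α − P/Q‖ < q^{-n}; since α ∈ 𝔪, also |P/Q| < 1, i.e. deg P < deg Q.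
-- If a fraction A/B with deg B < deg Q were within q^{-n} of P/Q, the
-- ultrametric inequality would put it within q^{-n} of α, making B an
-- admissible denominator of degree below the minimal one.  To conclude
-- constructively that A/B is far from P/Q, note that the expansions of
-- rational functions vanish above some degree, so ‖A/B − P/Q‖ ≥ q^{-n}
-- is decided by finitely many coefficients; and the expansion of P/Q
-- is unique, so it does not matter which one the distance is computed with.
module Submission where

open import Defs
open import Data.Nat using (ℕ; _≤_)
open import Data.Fin using (Fin)
open import Data.Product using (∃; _×_)

open import Level using (0ℓ)
open import Algebra.Bundles using (CommutativeRing)
import Algebra.Properties.CommutativeSemigroup as CommutativeSemigroupProperties
import Algebra.Properties.Ring as RingProperties
open import Data.Empty using (⊥-elim)
import Data.Fin.Properties as Finₚ
import Data.Integer.Base as ℤ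
open ℤ using (ℤ; +_; -[1+_]; +≤+; +<+; -≤+)
import Data.Integer.Properties as ℤₚ
open import Data.Integer.Tactic.RingSolver using (solve-∀)
open import Data.List.Base using ([]; _∷_)
open import Data.Nat.Base using (zero; suc)
import Data.Nat.Base as ℕ
import Data.Nat.Properties as ℕₚ
open import Data.Product using (_,_; proj₁; proj₂)
open import Data.Sum using (_⊎_; inj₁; inj₂; map₂)
open import Function.Base using (_∘_)
open import Function.Properties.Inverse using (↔⇒↣; ↔-sym)
open import Relation.Binary.Definitions using (tri<; tri≈; tri>)
open import Relation.Binary.PropositionalEquality
open import Relation.Nullary using (¬_; yes; no)
open import Relation.Nullary.Decidable
  using (Dec; map′; ¬?; via-injection; decidable-stable)

i≤+∣i∣ : ∀ i → i ℤ.≤ + ℤ.∣ i ∣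
i≤+∣i∣ (+ n)    = ℤₚ.≤-refl
i≤+∣i∣ -[1+ n ] = -≤+

i<[i+k]-j : ∀ i {j k} → j ℕ.< k → i ℤ.< (i ℤ.+ + k) ℤ.- + j
i<[i+k]-j i {j} j<k with ℕₚ.m≤n⇒∃[o]m+o≡n j<k
... | d , refl = ℤₚ.suc[i]≤j⇒i<j
  (subst (ℤ.suc i ℤ.≤_) (sym (regroup i (+ j) (+ d))) (ℤₚ.i≤i+j (ℤ.suc i) (+ d)))
  where
  regroup : ∀ i j d → (i ℤ.+ (+ 1 ℤ.+ j ℤ.+ d)) ℤ.- j ≡ (+ 1 ℤ.+ i) ℤ.+ d
  regroup = solve-∀

bounded-downward-induction : (P : ℤ → Set) (N : ℤ) → (∀ i → N ℤ.< i → P i) →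
  (∀ i → (∀ j → i ℤ.< j → P j) → P i) → ∀ i → P i
bounded-downward-induction P N above step i = within (suc ℤ.∣ N ℤ.- i ∣) i N<i+r
  where
  within : ∀ r i → N ℤ.< i ℤ.+ + r → P i
  within zero    i N<i   = above i (subst (N ℤ.<_) (ℤₚ.+-identityʳ i) N<i)
  within (suc r) i N<i+1+r = step i λ j i<j →
    within r j (ℤₚ.<-≤-trans N<i+1+r
      (subst (ℤ._≤ j ℤ.+ + r) (shift i (+ r)) (ℤₚ.+-monoˡ-≤ (+ r) (ℤₚ.i<j⇒suc[i]≤j i<j))))
    where
    shift : ∀ i r → (+ 1 ℤ.+ i) ℤ.+ r ≡ i ℤ.+ (+ 1 ℤ.+ r)
    shift = solve-∀

  N<i+r : N ℤ.< i ℤ.+ + suc ℤ.∣ N ℤ.- i ∣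
  N<i+r = ℤₚ.≤-<-trans
    (subst (ℤ._≤ i ℤ.+ + ℤ.∣ N ℤ.- i ∣) (i+[N-i]≡N i N) (ℤₚ.+-monoʳ-≤ i (i≤+∣i∣ (N ℤ.- i))))
    (ℤₚ.+-monoʳ-< i (+<+ (ℕₚ.n<1+n _)))
    where
    i+[N-i]≡N : ∀ i N → i ℤ.+ (N ℤ.- i) ≡ N
    i+[N-i]≡N = solve-∀

module Laurent (𝔽 : FiniteField) where
  open FiniteField 𝔽
  open Poly 𝔽
  open ≡-Reasoning

  ring : CommutativeRing 0ℓ 0ℓ
  ring = record { isCommutativeRing = isCommutativeRing }

  open CommutativeRing ring
    using (_-_; +-commutativeSemigroup; +-identityˡ; +-identityʳ; -‿inverseʳ;
           *-identityˡ; *-comm; *-assoc; zeroˡ; zeroʳ)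
  open RingProperties (CommutativeRing.ring ring)
    using (x∙y⁻¹≈ε⇒x≈y; x≈y⇒x∙y⁻¹≈ε; -‿+-comm; x[y-z]≈xy-xz)
  open CommutativeSemigroupProperties +-commutativeSemigroup using (interchange)

  _≟_ : (x y : Carrier) → Dec (x ≡ y)
  _≟_ = via-injection (↔⇒↣ (↔-sym enum)) Finₚ._≟_

  nonzero-cancel : ∀ {x y} → x ≢ 0# → x * y ≡ 0# → y ≡ 0#
  nonzero-cancel {x} {y} x≢0 xy≡0 with inverse x x≢0
  ... | x⁻¹ , xx⁻¹≡1 = begin
    y              ≡⟨ sym (*-identityˡ y) ⟩
    1# * y         ≡⟨ cong (_* y) (trans (sym xx⁻¹≡1) (*-comm x x⁻¹)) ⟩
    (x⁻¹ * x) * y  ≡⟨ *-assoc x⁻¹ x y ⟩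
    x⁻¹ * (x * y)  ≡⟨ cong (x⁻¹ *_) xy≡0 ⟩
    x⁻¹ * 0#       ≡⟨ zeroʳ x⁻¹ ⟩
    0#             ∎

  DegEq-unique : ∀ p {a b} → DegEq p a → DegEq p b → a ≡ b
  DegEq-unique p {a} {b} (pa≢0 , above-a) (pb≢0 , above-b) with ℕₚ.<-cmp a b
  ... | tri< a<b _ _ = ⊥-elim (pb≢0 (above-a b a<b))
  ... | tri≈ _ a≡b _ = a≡b
  ... | tri> _ _ b<a = ⊥-elim (pa≢0 (above-b a b<a))

  BoundedAbove : Series → Set
  BoundedAbove C = ∃ λ N → ∀ i → N ℤ.< i → C i ≡ 0#

  ⊖-boundedAbove : ∀ {C C′} → BoundedAbove C → BoundedAbove C′ → BoundedAbove (C ⊖ C′)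
  ⊖-boundedAbove (N , C-bounded) (N′ , C′-bounded) = N ℤ.⊔ N′ , λ i N⊔N′<i →
    x≈y⇒x∙y⁻¹≈ε (trans (C-bounded i (ℤₚ.≤-<-trans (ℤₚ.i≤i⊔j N N′) N⊔N′<i))
                       (sym (C′-bounded i (ℤₚ.≤-<-trans (ℤₚ.i≤j⊔i N N′) N⊔N′<i))))

  NormLt⇒agree : ∀ {α β n} → NormLt (α ⊖ β) n → ∀ i → ℤ.- + n ℤ.≤ i → α i ≡ β i
  NormLt⇒agree close i le = x∙y⁻¹≈ε⇒x≈y _ _ (close i le)

  agree⇒NormLt : ∀ {α β n} → (∀ i → ℤ.- + n ℤ.≤ i → α i ≡ β i) → NormLt (α ⊖ β) n
  agree⇒NormLt agree i le = x≈y⇒x∙y⁻¹≈ε (agree i le)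

  In𝔪-close : ∀ {α β n} → In𝔪 α → NormLt (α ⊖ β) n → In𝔪 β
  In𝔪-close α∈𝔪 close i 0≤i =
    trans (sym (NormLt⇒agree close i (ℤₚ.≤-trans ℤₚ.neg-≤-pos 0≤i))) (α∈𝔪 i 0≤i)

  ¬NormGe⇒NormLt : ∀ {D n} → ¬ NormGe D n → NormLt D n
  ¬NormGe⇒NormLt {D} ¬ge i le = decidable-stable (D i ≟ 0#) λ Dᵢ≢0 → ¬ge (i , le , Dᵢ≢0)

  NormGe? : ∀ {D} → BoundedAbove D → ∀ n → Dec (NormGe D n)
  NormGe? {D} (N , D-bounded) n =
    map′ fromWindow toWindow (ℕₚ.anyUpTo? (λ r → ¬? (D (lo ℤ.+ + r) ≟ 0#)) window)
    where
    lo : ℤ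
    lo = ℤ.- + n

    window : ℕ
    window = suc ℤ.∣ N ℤ.+ + n ∣

    fromWindow : (∃ λ r → r ℕ.< window × D (lo ℤ.+ + r) ≢ 0#) → NormGe D n
    fromWindow (r , _ , Dᵣ≢0) = lo ℤ.+ + r , ℤₚ.i≤i+j lo (+ r) , Dᵣ≢0

    toWindow : NormGe D n → ∃ λ r → r ℕ.< window × D (lo ℤ.+ + r) ≢ 0#
    toWindow (i , lo≤i , Dᵢ≢0) =
      ℤ.∣ i ℤ.+ + n ∣ , ℕ.s≤s (ℤₚ.drop‿+≤+ r≤) , subst (λ s → D s ≢ 0#) (sym lo+r≡i) Dᵢ≢0
      where
      0≤i+n : + 0 ℤ.≤ i ℤ.+ + n
      0≤i+n = subst (ℤ._≤ i ℤ.+ + n) (ℤₚ.+-inverseˡ (+ n)) (ℤₚ.+-monoˡ-≤ (+ n) lo≤i)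

      +r≡i+n : + ℤ.∣ i ℤ.+ + n ∣ ≡ i ℤ.+ + n
      +r≡i+n = ℤₚ.0≤i⇒+∣i∣≡i 0≤i+n

      lo+r≡i : lo ℤ.+ + ℤ.∣ i ℤ.+ + n ∣ ≡ i
      lo+r≡i = trans (cong (λ s → lo ℤ.+ s) +r≡i+n) (cancel (+ n) i)
        where
        cancel : ∀ n i → ℤ.- n ℤ.+ (i ℤ.+ n) ≡ i
        cancel = solve-∀

      r≤ : + ℤ.∣ i ℤ.+ + n ∣ ℤ.≤ + ℤ.∣ N ℤ.+ + n ∣
      r≤ = subst (ℤ._≤ _) (sym +r≡i+n)
             (ℤₚ.≤-trans (ℤₚ.+-monoˡ-≤ (+ n) (ℤₚ.≮⇒≥ λ N<i → Dᵢ≢0 (D-bounded i N<i)))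
                         (i≤+∣i∣ (N ℤ.+ + n)))

  -- The j-th summand of (p ⊛ D) t is coeff p j * D (t - j).
  VanishingTerm : Pol → Series → ℤ → ℕ → Set
  VanishingTerm p D t j = coeff p j ≡ 0# ⊎ D (t ℤ.- + j) ≡ 0#

  head-term-vanishes : ∀ {a} (D : Series) t → a ≡ 0# ⊎ D (t ℤ.- + 0) ≡ 0# → a * D t ≡ 0#
  head-term-vanishes D t (inj₁ a≡0) = trans (cong (λ x → x * D t) a≡0) (zeroˡ (D t))
  head-term-vanishes {a} D t (inj₂ D≡0) =
    trans (cong (λ s → a * D s) (sym (ℤₚ.+-identityʳ t))) (trans (cong (a *_) D≡0) (zeroʳ a))

  tail-term-vanishes : ∀ {X : Set} (D : Series) t j → X ⊎ D (t ℤ.- + suc j) ≡ 0# →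
                       X ⊎ D ((t ℤ.- + 1) ℤ.- + j) ≡ 0#
  tail-term-vanishes D t j = map₂ (trans (cong D (reindex t (+ j))))
    where
    reindex : ∀ t j → (t ℤ.- + 1) ℤ.- j ≡ t ℤ.- (+ 1 ℤ.+ j)
    reindex = solve-∀

  ⊛-vanishes : ∀ p D t → (∀ j → VanishingTerm p D t j) → (p ⊛ D) t ≡ 0#
  ⊛-vanishes []      D t _     = refl
  ⊛-vanishes (a ∷ p) D t terms = begin
    a * D t + (p ⊛ D) (t ℤ.- + 1)
      ≡⟨ cong₂ _+_ (head-term-vanishes D t (terms 0))
                   (⊛-vanishes p D _ λ j → tail-term-vanishes D t j (terms (suc j))) ⟩
    0# + 0#  ≡⟨ +-identityʳ 0# ⟩
    0#       ∎

  ⊛-single-term : ∀ p D t k → (∀ j → j ≢ k → VanishingTerm p D t j) →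
                  (p ⊛ D) t ≡ coeff p k * D (t ℤ.- + k)
  ⊛-single-term []      D t k       _     = sym (zeroˡ _)
  ⊛-single-term (a ∷ p) D t zero    terms = begin
    a * D t + (p ⊛ D) (t ℤ.- + 1)
      ≡⟨ cong (λ s → a * D t + s) (⊛-vanishes p D _ λ j →
           tail-term-vanishes D t j (terms (suc j) λ ())) ⟩
    a * D t + 0#            ≡⟨ +-identityʳ _ ⟩
    a * D t                 ≡⟨ cong (λ s → a * D s) (sym (ℤₚ.+-identityʳ t)) ⟩
    a * D (t ℤ.- + 0)       ∎
  ⊛-single-term (a ∷ p) D t (suc k) terms = begin
    a * D t + (p ⊛ D) (t ℤ.- + 1)
      ≡⟨ cong₂ _+_ (head-term-vanishes D t (terms 0 λ ()))
                   (⊛-single-term p D _ k λ j j≢k →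
                      tail-term-vanishes D t j (terms (suc j) (j≢k ∘ ℕₚ.suc-injective))) ⟩
    0# + coeff p k * D ((t ℤ.- + 1) ℤ.- + k)  ≡⟨ +-identityˡ _ ⟩
    coeff p k * D ((t ℤ.- + 1) ℤ.- + k)       ≡⟨ cong (λ s → coeff p k * D s) (reindex t (+ k)) ⟩
    coeff p k * D (t ℤ.- + suc k)             ∎
    where
    reindex : ∀ t k → (t ℤ.- + 1) ℤ.- k ≡ t ℤ.- (+ 1 ℤ.+ k)
    reindex = solve-∀

  ⊛-⊖ : ∀ p C C′ t → (p ⊛ (C ⊖ C′)) t ≡ (p ⊛ C) t - (p ⊛ C′) t
  ⊛-⊖ []      C C′ t = sym (-‿inverseʳ 0#)
  ⊛-⊖ (a ∷ p) C C′ t = begin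
    a * (C t - C′ t) + (p ⊛ (C ⊖ C′)) t′
      ≡⟨ cong₂ _+_ (x[y-z]≈xy-xz a (C t) (C′ t)) (⊛-⊖ p C C′ t′) ⟩
    (a * C t - a * C′ t) + ((p ⊛ C) t′ - (p ⊛ C′) t′)
      ≡⟨ interchange _ _ _ _ ⟩
    (a * C t + (p ⊛ C) t′) + (- (a * C′ t) + - (p ⊛ C′) t′)
      ≡⟨ cong (λ s → a * C t + (p ⊛ C) t′ + s) (-‿+-comm _ _) ⟩
    (a * C t + (p ⊛ C) t′) - (a * C′ t + (p ⊛ C′) t′)  ∎
    where
    t′ = t ℤ.- + 1

  -- Descending induction from the bound: once D vanishes above i, the
  -- coefficient of x^{i+k} in Q ⊛ D is (lead Q) · D i.
  ⊛≡0⇒≡0 : ∀ Q {k} D → DegEq Q k → BoundedAbove D → (∀ t → (Q ⊛ D) t ≡ 0#) →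
           ∀ i → D i ≡ 0#
  ⊛≡0⇒≡0 Q {k} D (Qₖ≢0 , Q-top) (N , D-bounded) QD≡0 =
    bounded-downward-induction (λ i → D i ≡ 0#) N D-bounded leading
    where
    leading : ∀ i → (∀ j → i ℤ.< j → D j ≡ 0#) → D i ≡ 0#
    leading i higher = nonzero-cancel Qₖ≢0 (begin
      coeff Q k * D i                       ≡⟨ cong (λ s → coeff Q k * D s) (sym ([i+k]-k≡i i (+ k))) ⟩
      coeff Q k * D ((i ℤ.+ + k) ℤ.- + k)   ≡⟨ sym (⊛-single-term Q D (i ℤ.+ + k) k others) ⟩
      (Q ⊛ D) (i ℤ.+ + k)                   ≡⟨ QD≡0 _ ⟩
      0#                                    ∎)
      where
      [i+k]-k≡i : ∀ i k → (i ℤ.+ k) ℤ.- k ≡ i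
      [i+k]-k≡i = solve-∀

      others : ∀ j → j ≢ k → VanishingTerm Q D (i ℤ.+ + k) j
      others j j≢k with ℕₚ.<-cmp j k
      ... | tri< j<k _ _ = inj₂ (higher _ (i<[i+k]-j i j<k))
      ... | tri≈ _ j≡k _ = ⊥-elim (j≢k j≡k)
      ... | tri> _ _ k<j = inj₁ (Q-top j k<j)

  IsQuot-unique : ∀ {C C′} P Q {k} → DegEq Q k → IsQuot C P Q → IsQuot C′ P Q →
                  ∀ i → C i ≡ C′ i
  IsQuot-unique {C} {C′} P Q degQ (C-bounded , QC≡P) (C′-bounded , QC′≡P) i =
    x∙y⁻¹≈ε⇒x≈y _ _ (⊛≡0⇒≡0 Q (C ⊖ C′) degQ (⊖-boundedAbove C-bounded C′-bounded) QD≡0 i)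
    where
    QD≡0 : ∀ t → (Q ⊛ (C ⊖ C′)) t ≡ 0#
    QD≡0 t = trans (⊛-⊖ Q C C′ t) (x≈y⇒x∙y⁻¹≈ε (trans (QC≡P t) (sym (QC′≡P t))))

  numerator-DegLt : ∀ {C} P Q {k} → DegLt Q (suc k) → IsQuot C P Q → In𝔪 C → DegLt P k
  numerator-DegLt {C} P Q {k} Q-top (_ , QC≡P) C∈𝔪 i k≤i =
    trans (sym (QC≡P (+ i))) (⊛-vanishes Q C (+ i) term)
    where
    term : ∀ j → VanishingTerm Q C (+ i) j
    term j with k ℕₚ.<? j
    ... | yes k<j = inj₁ (Q-top j k<j)
    ... | no  k≮j = inj₂ (C∈𝔪 _ (ℤₚ.i≤j⇒0≤j-i (+≤+ (ℕₚ.≤-trans (ℕₚ.≮⇒≥ k≮j) k≤i))))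

mainTheorem4 : (𝔽 : FiniteField) → let open Poly 𝔽 in
    (S : PolSet) → RespectsEq S → SubsetMonic S → Infinite S →
    (m n k : ℕ) → (M : ℕ) → IsMS S n M → k ≤ M →
    (Q : Pol) → DegEq Q k → S Q →
    (α : Fin m → Series) → (∀ j → In𝔪 (α j)) →
    QminIs S α n Q →
    ∃ λ (P : Fin m → Pol) → (∀ j → DegLt (P j) k) × Primitive (P ,, Q) ×
      ((A : Fin m → Pol) (B : Pol) → FareyBelow S k A B →
       (CA CP : Fin m → Series) →
       (∀ j → IsQuot (CA j) (A j) B) → (∀ j → IsQuot (CP j) (P j) Q) →
       NormGeᵥ (λ j → CA j ⊖ CP j) n)
mainTheorem4 𝔽 S _ _ _ m n k _ _ _ Q degQ _ α α∈𝔪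
             (_ , _ , _ , (_ , minimal) , degQ′ , P , primPQ , C , quotC , closeC) =
  P , degP , primPQ , farFromFarey
  where
  open Poly 𝔽
  open Laurent 𝔽

  degP : ∀ j → DegLt (P j) k
  degP j = numerator-DegLt (P j) Q (proj₂ degQ) (quotC j) (In𝔪-close (α∈𝔪 j) (closeC j))

  farFromFarey : (A : Fin m → Pol) (B : Pol) → FareyBelow S k A B →
    (CA CP : Fin m → Series) →
    (∀ j → IsQuot (CA j) (A j) B) → (∀ j → IsQuot (CP j) (P j) Q) →
    NormGeᵥ (λ j → CA j ⊖ CP j) n
  farFromFarey A B (SB , primAB , d′ , degB , d′<k , degA) CA CP quotA quotP =
    decidable-stable far? λ ¬far → ℕₚ.<⇒≱ d′<k
      (subst (_≤ d′) (sym (DegEq-unique Q degQ degQ′))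
             (minimal B d′ (SB , degB , A , primAB , degA , CA , quotA , closeA ¬far)))
    where
    far? : Dec (NormGeᵥ (λ j → CA j ⊖ CP j) n)
    far? = Finₚ.any? λ j → NormGe? (⊖-boundedAbove (proj₁ (quotA j)) (proj₁ (quotP j))) n

    closeA : ¬ NormGeᵥ (λ j → CA j ⊖ CP j) n → NormLtᵥ (λ j → α j ⊖ CA j) n
    closeA ¬far j = agree⇒NormLt λ i le → begin
      α j i   ≡⟨ NormLt⇒agree (closeC j) i le ⟩
      C j i   ≡⟨ IsQuot-unique (P j) Q degQ (quotC j) (quotP j) i ⟩
      CP j i  ≡⟨ sym (NormLt⇒agree (¬NormGe⇒NormLt (¬far ∘ (j ,_))) i le) ⟩
      CA j i  ∎
      where open ≡-Reasoning
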